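{- Let $G=(V,E)$ be a directed unweighted graph with $(s,t)$-max-flow value $\lambda$, and let $H=(V,E,c)$ be the capacitated graph with $c(e)=\lambda+1$ if $e$ is critical in $G$ and $c(e)=\lambda$ otherwise. Then the $(s,t)$-max-flow value of $H$ is $\lambda(\lambda+1)$.
   Context: $G$ has unit edge capacities (multigraphs allowed). An edge is critical in $G$ if it is contained in some $(s,t)$-min-cut of $G$.
   Formalization: The flows in G and in H take values in the rationals rather than in the nonnegative reals. -}

module Defs where

open import Data.Nat as ℕ using (ℕ; zero; suc)
open import Data.Fin using (Fin; zero; suc; _≟_)
open import Data.Bool using (Bool; true; false; if_then_else_)
open import Data.Product using (_×_; _,_; proj₁; proj₂; Σ; ∃)
open import Data.Rational using (ℚ; 0ℚ; 1ℚ; _+_; _-_; _≤_)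
open import Relation.Nullary using (does)
open import Data.Empty using (⊥)
open import Relation.Binary.PropositionalEquality using (_≡_)

record Graph : Set where
  field
    n     : ℕ
    m     : ℕ
    edges : Fin m → Fin n × Fin n

open Graph public

src : (G : Graph) → Fin (m G) → Fin (n G)
src G e = proj₁ (edges G e)

tgt : (G : Graph) → Fin (m G) → Fin (n G)
tgt G e = proj₂ (edges G e)

sumℚ : ∀ {k} → (Fin k → ℚ) → ℚ
sumℚ {zero}  f = 0ℚ
sumℚ {suc k} f = f zero + sumℚ (λ i → f (suc i))

countℕ : ∀ {k} → (Fin k → Bool) → ℕ
countℕ {zero}  p = 0
countℕ {suc k} p = (if p zero then 1 else 0) ℕ.+ countℕ (λ i → p (suc i))

inflow : (G : Graph) → (Fin (m G) → ℚ) → Fin (n G) → ℚ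
inflow G f v = sumℚ (λ e → if does (tgt G e ≟ v) then f e else 0ℚ)

outflow : (G : Graph) → (Fin (m G) → ℚ) → Fin (n G) → ℚ
outflow G f v = sumℚ (λ e → if does (src G e ≟ v) then f e else 0ℚ)

record IsFlow (G : Graph) (c : Fin (m G) → ℚ) (s t : Fin (n G))
              (f : Fin (m G) → ℚ) : Set where
  field
    nonneg       : ∀ e → 0ℚ ≤ f e
    capacity     : ∀ e → f e ≤ c e
    conservation : ∀ v → (v ≡ s → ⊥) → (v ≡ t → ⊥) →
                   inflow G f v ≡ outflow G f v

flowValue : (G : Graph) → (Fin (m G) → ℚ) → Fin (n G) → ℚ
flowValue G f s = outflow G f s - inflow G f s

IsMaxFlowValue : (G : Graph) (c : Fin (m G) → ℚ) (s t : Fin (n G)) → ℚ → Set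
IsMaxFlowValue G c s t v =
  (Σ (Fin (m G) → ℚ) λ f → IsFlow G c s t f × flowValue G f s ≡ v)
  × (∀ f → IsFlow G c s t f → flowValue G f s ≤ v)

unitCap : (G : Graph) → Fin (m G) → ℚ
unitCap G e = 1ℚ

IsCut : (G : Graph) (s t : Fin (n G)) → (Fin (n G) → Bool) → Set
IsCut G s t S = (S s ≡ true) × (S t ≡ false)

crosses : (G : Graph) → (Fin (n G) → Bool) → Fin (m G) → Bool
crosses G S e with S (src G e) | S (tgt G e)
... | true | false = true
... | _    | _     = false

cutValue : (G : Graph) → (Fin (n G) → Bool) → ℕ
cutValue G S = countℕ (crosses G S)

IsMinCut : (G : Graph) (s t : Fin (n G)) → (Fin (n G) → Bool) → Set
IsMinCut G s t S =
  IsCut G s t S × (∀ S′ → IsCut G s t S′ → cutValue G S ℕ.≤ cutValue G S′)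

Critical : (G : Graph) (s t : Fin (n G)) → Fin (m G) → Set
Critical G s t e =
  ∃ λ S → IsMinCut G s t S × (S (src G e) ≡ true) × (S (tgt G e) ≡ false)

module Submission where

-- Let ℓ be the size of a minimum (s,t)-cut of G; by max-flow/min-cut, λ = ℓ.  A minimum cut
-- of G consists of critical edges, so in H it has capacity ℓ(λ+1) = λ(λ+1), which bounds
-- every flow of H.  Conversely, any other cut of G has at least ℓ+1 edges, each of capacity
-- at least λ in H, so no cut of H has capacity below λ(λ+1).  The capacities of H are
-- integers, so augmenting along residual paths terminates with a flow of H whose value is
-- the capacity of some cut, hence at least λ(λ+1).

open import Defs
open import Algebra.Bundles using (CommutativeRing)
open import Data.Bool using (Bool; true; false; if_then_else_; _∧_; not)
open import Data.Fin using (Fin; zero; suc; _≟_)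
open import Data.Fin.Properties using (any?)
open import Data.Nat as ℕ using (ℕ; zero; suc)
import Data.Nat.Properties as ℕP
open import Data.Product using (_×_; _,_; proj₁; proj₂; Σ; ∃; ∃₂)
open import Data.Sum using (_⊎_; inj₁; inj₂)
open import Data.Unit using (⊤; tt)
import Data.Rational as ℚ
open import Data.Rational using (ℚ; 0ℚ; 1ℚ; _+_; _*_; _-_; -_; _≤_; _<_)
import Data.Rational.Properties as ℚP
open import Data.Rational.Solver using (module +-*-Solver)
open import Data.Vec.Functional using (Vector; updateAt)
open import Data.Vec.Functional.Properties using (updateAt-updates; updateAt-minimal)
open import Function using (_∘_)
open import Relation.Nullary using (Dec; yes; no; does; ¬_; ¬?; contradiction)
open import Relation.Nullary.Decidable using (dec-true; dec-false; _×-dec_; _⊎-dec_; map′)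
open import Relation.Binary.PropositionalEquality

open CommutativeRing ℚP.+-*-commutativeRing using (semiring; ring; *-commutativeSemigroup)
open import Algebra.Properties.Semiring.Sum semiring
  using (sum; sum-cong-≗; sum-replicate-zero; ∑-distrib-+; ∑-comm; *-distribˡ-sum)
open import Algebra.Properties.Semiring.Mult semiring using (×-homo-+) renaming (_×_ to _×ℚ_)
open import Algebra.Properties.Ring ring using (-1*x≈-x; x[y-z]≈xy-xz; [y-z]x≈yx-zx)
open import Algebra.Properties.Group ℚP.+-0-group using (x∙y⁻¹≈ε⇒x≈y)
open import Algebra.Properties.CommutativeSemigroup *-commutativeSemigroup using (x∙yz≈y∙xz)
open import Algebra.Definitions.RawMonoid ℕ.+-0-rawMonoid using () renaming (sum to sumℕ)
open +-*-Solver using (solve; _:=_; _:+_; _:*_; _:-_; :-_; con)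

𝟙 : Bool → ℚ
𝟙 true  = 1ℚ
𝟙 false = 0ℚ

δ : ∀ {k} → Fin k → Fin k → ℚ
δ i j = 𝟙 (does (i ≟ j))

δ-refl : ∀ {k} (i : Fin k) → δ i i ≡ 1ℚ
δ-refl i = cong 𝟙 (dec-true (i ≟ i) refl)

δ-≢ : ∀ {k} {i j : Fin k} → i ≢ j → δ i j ≡ 0ℚ
δ-≢ {i = i} {j} i≢j = cong 𝟙 (dec-false (i ≟ j) i≢j)

if-then-0 : ∀ b x → (if b then x else 0ℚ) ≡ 𝟙 b * x
if-then-0 true  x = sym (ℚP.*-identityˡ x)
if-then-0 false x = sym (ℚP.*-zeroˡ x)

𝟙*-monoʳ-≤ : ∀ b {x y} → x ≤ y → 𝟙 b * x ≤ 𝟙 b * y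
𝟙*-monoʳ-≤ true  {x} {y} x≤y = subst₂ _≤_ (sym (ℚP.*-identityˡ x)) (sym (ℚP.*-identityˡ y)) x≤y
𝟙*-monoʳ-≤ false {x} {y} _   = ℚP.≤-reflexive (trans (ℚP.*-zeroˡ x) (sym (ℚP.*-zeroˡ y)))

does-true : ∀ {A : Set} (a? : Dec A) → does a? ≡ true → A
does-true (yes a) _ = a

sumℚ≡sum : ∀ {k} (f : Vector ℚ k) → sumℚ f ≡ sum f
sumℚ≡sum {zero}  f = refl
sumℚ≡sum {suc k} f = cong (f zero +_) (sumℚ≡sum (f ∘ suc))

sum-neg : ∀ {k} (f : Vector ℚ k) → sum (λ i → - f i) ≡ - sum f
sum-neg {zero}  f = refl
sum-neg {suc k} f = trans (cong (- f zero +_) (sum-neg (f ∘ suc))) (sym (ℚP.neg-distrib-+ (f zero) _))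

sum-- : ∀ {k} (f g : Vector ℚ k) → sum (λ i → f i - g i) ≡ sum f - sum g
sum-- f g = trans (∑-distrib-+ f (λ i → - g i)) (cong (sum f +_) (sum-neg g))

sum-zero : ∀ {k} {f : Vector ℚ k} → (∀ i → f i ≡ 0ℚ) → sum f ≡ 0ℚ
sum-zero {k} f≗0 = trans (sum-cong-≗ f≗0) (sum-replicate-zero k)

sum-δ : ∀ {k} (i : Fin k) (F : Vector ℚ k) → sum (λ j → δ i j * F j) ≡ F i
sum-δ zero    F = begin
  1ℚ * F zero + sum (λ j → 0ℚ * F (suc j))
    ≡⟨ cong₂ _+_ (ℚP.*-identityˡ (F zero)) (sum-zero (ℚP.*-zeroˡ ∘ F ∘ suc)) ⟩
  F zero + 0ℚ
    ≡⟨ ℚP.+-identityʳ (F zero) ⟩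
  F zero
    ∎
  where open ≡-Reasoning
sum-δ (suc i) F = begin
  0ℚ * F zero + sum (λ j → δ i j * F (suc j))  ≡⟨ cong₂ _+_ (ℚP.*-zeroˡ (F zero)) (sum-δ i (F ∘ suc)) ⟩
  0ℚ + F (suc i)                               ≡⟨ ℚP.+-identityˡ (F (suc i)) ⟩
  F (suc i)                                    ∎
  where open ≡-Reasoning

sum-mono : ∀ {k} {f g : Vector ℚ k} → (∀ i → f i ≤ g i) → sum f ≤ sum g
sum-mono {zero}  f≤g = ℚP.≤-refl
sum-mono {suc k} f≤g = ℚP.+-mono-≤ (f≤g zero) (sum-mono (f≤g ∘ suc))

countℕ-≤ : ∀ {k} (p : Vector Bool k) → countℕ p ℕ.≤ k
countℕ-≤ {zero}  p = ℕ.z≤n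
countℕ-≤ {suc k} p with p zero
... | true  = ℕ.s≤s (countℕ-≤ (p ∘ suc))
... | false = ℕP.m≤n⇒m≤1+n (countℕ-≤ (p ∘ suc))

countℕ-mono-≤ : ∀ {k} {p q : Vector Bool k} → (∀ i → p i ≡ true → q i ≡ true) → countℕ p ℕ.≤ countℕ q
countℕ-mono-≤ {zero}          p⊆q = ℕ.z≤n
countℕ-mono-≤ {suc k} {p} {q} p⊆q with p zero in p₀ | q zero in q₀
... | true  | true  = ℕ.s≤s (countℕ-mono-≤ (p⊆q ∘ suc))
... | false | true  = ℕP.m≤n⇒m≤1+n (countℕ-mono-≤ (p⊆q ∘ suc))
... | false | false = countℕ-mono-≤ (p⊆q ∘ suc)
... | true  | false = contradiction (trans (sym (p⊆q zero p₀)) q₀) λ ()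

countℕ-mono-< : ∀ {k} {p q : Vector Bool k} → (∀ i → p i ≡ true → q i ≡ true) →
                ∀ w → p w ≡ false → q w ≡ true → countℕ p ℕ.< countℕ q
countℕ-mono-< {suc k} {p} {q} p⊆q zero pw qw rewrite pw | qw = ℕ.s≤s (countℕ-mono-≤ (p⊆q ∘ suc))
countℕ-mono-< {suc k} {p} {q} p⊆q (suc w) pw qw with p zero in p₀ | q zero in q₀
... | true  | true  = ℕ.s≤s (countℕ-mono-< (p⊆q ∘ suc) w pw qw)
... | false | true  = ℕP.m≤n⇒m≤1+n (countℕ-mono-< (p⊆q ∘ suc) w pw qw)
... | false | false = countℕ-mono-< (p⊆q ∘ suc) w pw qw
... | true  | false = contradiction (trans (sym (p⊆q zero p₀)) q₀) λ ()

ℕ→ℚ : ℕ → ℚ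
ℕ→ℚ n = n ×ℚ 1ℚ

ℕ→ℚ-+ : ∀ m n → ℕ→ℚ (m ℕ.+ n) ≡ ℕ→ℚ m + ℕ→ℚ n
ℕ→ℚ-+ = ×-homo-+ 1ℚ

ℕ→ℚ-pred : ∀ {x} → 0 ℕ.< x → ℕ→ℚ (ℕ.pred x) ≡ ℕ→ℚ x + - 1ℚ
ℕ→ℚ-pred {suc x} _ = solve 1 (λ y → y := (con 1ℚ :+ y) :+ :- con 1ℚ) refl (ℕ→ℚ x)

ℕ→ℚ-nonNeg : ∀ n → 0ℚ ≤ ℕ→ℚ n
ℕ→ℚ-nonNeg zero    = ℚP.≤-refl
ℕ→ℚ-nonNeg (suc n) = ℚP.+-mono-≤ (ℚP.<⇒≤ (ℚP.positive⁻¹ 1ℚ)) (ℕ→ℚ-nonNeg n)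

ℕ→ℚ-mono-≤ : ∀ {m n} → m ℕ.≤ n → ℕ→ℚ m ≤ ℕ→ℚ n
ℕ→ℚ-mono-≤ {n = n} ℕ.z≤n = ℕ→ℚ-nonNeg n
ℕ→ℚ-mono-≤ (ℕ.s≤s m≤n)   = ℚP.+-monoʳ-≤ 1ℚ (ℕ→ℚ-mono-≤ m≤n)

ℕ→ℚ-<-suc : ∀ n → ℕ→ℚ n < ℕ→ℚ (suc n)
ℕ→ℚ-<-suc n = ℚP.<-respˡ-≡ (ℚP.+-identityˡ (ℕ→ℚ n)) (ℚP.+-monoˡ-< (ℕ→ℚ n) (ℚP.positive⁻¹ 1ℚ))

ℕ→ℚ-cancel-≤ : ∀ {m n} → ℕ→ℚ m ≤ ℕ→ℚ n → m ℕ.≤ n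
ℕ→ℚ-cancel-≤ {m} {n} p with m ℕ.≤? n
... | yes m≤n = m≤n
... | no  m≰n = contradiction
      (ℚP.<-≤-trans (ℕ→ℚ-<-suc n) (ℚP.≤-trans (ℕ→ℚ-mono-≤ (ℕP.≰⇒> m≰n)) p)) (ℚP.<-irrefl refl)

sum-ℕ→ℚ : ∀ {k} (g : Vector ℕ k) → sum (ℕ→ℚ ∘ g) ≡ ℕ→ℚ (sumℕ g)
sum-ℕ→ℚ {zero}  g = refl
sum-ℕ→ℚ {suc k} g = trans (cong (ℕ→ℚ (g zero) +_) (sum-ℕ→ℚ (g ∘ suc))) (sym (ℕ→ℚ-+ (g zero) _))

sum-count : ∀ {k} (p : Vector Bool k) q → sum (λ i → 𝟙 (p i) * q) ≡ ℕ→ℚ (countℕ p) * q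
sum-count {zero}  p q = sym (ℚP.*-zeroˡ q)
sum-count {suc k} p q = begin
  𝟙 (p zero) * q + sum (λ i → 𝟙 (p (suc i)) * q)
    ≡⟨ cong₂ (λ a b → a * q + b) (𝟙≡ℕ→ℚ (p zero)) (sum-count (p ∘ suc) q) ⟩
  ℕ→ℚ b₀ * q + ℕ→ℚ (countℕ (p ∘ suc)) * q
    ≡⟨ ℚP.*-distribʳ-+ q (ℕ→ℚ b₀) _ ⟨
  (ℕ→ℚ b₀ + ℕ→ℚ (countℕ (p ∘ suc))) * q
    ≡⟨ cong (_* q) (ℕ→ℚ-+ b₀ _) ⟨
  ℕ→ℚ (countℕ p) * q
    ∎
  where
  open ≡-Reasoning
  b₀ = if p zero then 1 else 0
  𝟙≡ℕ→ℚ : ∀ b → 𝟙 b ≡ ℕ→ℚ (if b then 1 else 0)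
  𝟙≡ℕ→ℚ true  = refl
  𝟙≡ℕ→ℚ false = refl

ℕ→ℚ-updateAt : ∀ {k} (g : Vector ℕ k) e {φ : ℕ → ℕ} d → ℕ→ℚ (φ (g e)) ≡ ℕ→ℚ (g e) + d →
               ∀ i → ℕ→ℚ (updateAt g e φ i) ≡ ℕ→ℚ (g i) + δ e i * d
ℕ→ℚ-updateAt g e {φ} d φ≡g+d i with e ≟ i
... | yes refl = begin
  ℕ→ℚ (updateAt g e φ e)   ≡⟨ cong ℕ→ℚ (updateAt-updates e g) ⟩
  ℕ→ℚ (φ (g e))            ≡⟨ φ≡g+d ⟩
  ℕ→ℚ (g e) + d            ≡⟨ cong (ℕ→ℚ (g e) +_) (ℚP.*-identityˡ d) ⟨
  ℕ→ℚ (g e) + 1ℚ * d       ∎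
  where open ≡-Reasoning
... | no e≢i = begin
  ℕ→ℚ (updateAt g e φ i)   ≡⟨ cong ℕ→ℚ (updateAt-minimal i e g (e≢i ∘ sym)) ⟩
  ℕ→ℚ (g i)                ≡⟨ ℚP.+-identityʳ (ℕ→ℚ (g i)) ⟨
  ℕ→ℚ (g i) + 0ℚ           ≡⟨ cong (ℕ→ℚ (g i) +_) (ℚP.*-zeroˡ d) ⟨
  ℕ→ℚ (g i) + 0ℚ * d       ∎
  where open ≡-Reasoning

-- Flows and cuts

module _ (G : Graph) where

  incidence : (Fin (m G) → Fin (n G)) → Vector ℚ (m G) → Fin (n G) → ℚ
  incidence end f v = sum (λ e → δ (end e) v * f e)

  net : Vector ℚ (m G) → Fin (n G) → ℚ
  net f v = incidence (src G) f v - incidence (tgt G) f v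

  cutCap : Vector ℚ (m G) → (Fin (n G) → Bool) → ℚ
  cutCap c S = sum (λ e → 𝟙 (crosses G S e) * c e)

  flowAcross : (Fin (n G) → Bool) → Vector ℚ (m G) → ℚ
  flowAcross S f = sum (λ e → (𝟙 (S (src G e)) - 𝟙 (S (tgt G e))) * f e)

  crosses≡ : (S : Fin (n G) → Bool) (e : Fin (m G)) → crosses G S e ≡ S (src G e) ∧ not (S (tgt G e))
  crosses≡ S e with S (src G e) | S (tgt G e)
  ... | true  | true  = refl
  ... | true  | false = refl
  ... | false | _     = refl

  net≡outflow-inflow : (f : Vector ℚ (m G)) (v : Fin (n G)) → net f v ≡ outflow G f v - inflow G f v
  net≡outflow-inflow f v = sym (cong₂ _-_ (selected (src G)) (selected (tgt G)))
    where
    selected : (end : Fin (m G) → Fin (n G)) →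
               sumℚ (λ e → if does (end e ≟ v) then f e else 0ℚ) ≡ incidence end f v
    selected end = trans (sumℚ≡sum (λ e → if does (end e ≟ v) then f e else 0ℚ))
                         (sum-cong-≗ (λ e → if-then-0 (does (end e ≟ v)) (f e)))

  flowValue≡net : (f : Vector ℚ (m G)) (s : Fin (n G)) → flowValue G f s ≡ net f s
  flowValue≡net f s = sym (net≡outflow-inflow f s)

  net≡0 : ∀ {c s t f} → IsFlow G c s t f → ∀ v → v ≢ s → v ≢ t → net f v ≡ 0ℚ
  net≡0 {f = f} flow v v≢s v≢t = begin
    net f v                         ≡⟨ net≡outflow-inflow f v ⟩
    outflow G f v - inflow G f v    ≡⟨ cong (λ x → outflow G f v - x) (IsFlow.conservation flow v v≢s v≢t) ⟩
    outflow G f v - outflow G f v   ≡⟨ ℚP.+-inverseʳ (outflow G f v) ⟩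
    0ℚ                              ∎
    where open ≡-Reasoning

  balanced⇒conservation : ∀ f v → net f v ≡ 0ℚ → inflow G f v ≡ outflow G f v
  balanced⇒conservation f v net≡0 =
    sym (x∙y⁻¹≈ε⇒x≈y (outflow G f v) (inflow G f v) (trans (sym (net≡outflow-inflow f v)) net≡0))

  sum-incidence : (S : Fin (n G) → Bool) (end : Fin (m G) → Fin (n G)) (f : Vector ℚ (m G)) →
                  sum (λ v → 𝟙 (S v) * incidence end f v) ≡ sum (λ e → 𝟙 (S (end e)) * f e)
  sum-incidence S end f = begin
    sum (λ v → 𝟙 (S v) * sum (λ e → δ (end e) v * f e))
      ≡⟨ sum-cong-≗ (λ v → *-distribˡ-sum (𝟙 (S v)) (λ e → δ (end e) v * f e)) ⟩
    sum (λ v → sum (λ e → 𝟙 (S v) * (δ (end e) v * f e)))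
      ≡⟨ ∑-comm (λ v e → 𝟙 (S v) * (δ (end e) v * f e)) ⟩
    sum (λ e → sum (λ v → 𝟙 (S v) * (δ (end e) v * f e)))
      ≡⟨ sum-cong-≗ (λ e → sum-cong-≗ (λ v → x∙yz≈y∙xz (𝟙 (S v)) (δ (end e) v) (f e))) ⟩
    sum (λ e → sum (λ v → δ (end e) v * (𝟙 (S v) * f e)))
      ≡⟨ sum-cong-≗ (λ e → sum-δ (end e) (λ v → 𝟙 (S v) * f e)) ⟩
    sum (λ e → 𝟙 (S (end e)) * f e)
      ∎
    where open ≡-Reasoning

  sum-net≡flowAcross : (S : Fin (n G) → Bool) (f : Vector ℚ (m G)) →
                       sum (λ v → 𝟙 (S v) * net f v) ≡ flowAcross S f
  sum-net≡flowAcross S f = begin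
    sum (λ v → 𝟙 (S v) * net f v)   ≡⟨ sum-cong-≗ (λ v → x[y-z]≈xy-xz (𝟙 (S v)) _ _) ⟩
    sum (λ v → out v - in′ v)       ≡⟨ sum-- out in′ ⟩
    sum out - sum in′               ≡⟨ cong₂ _-_ (sum-incidence S (src G) f) (sum-incidence S (tgt G) f) ⟩
    sum out′ - sum in″              ≡⟨ sum-- out′ in″ ⟨
    sum (λ e → out′ e - in″ e)      ≡⟨ sum-cong-≗ (λ e → [y-z]x≈yx-zx (f e) (S-src e) (S-tgt e)) ⟨
    flowAcross S f                  ∎
    where
    open ≡-Reasoning
    out in′ : Vector ℚ (n G)
    out v = 𝟙 (S v) * incidence (src G) f v
    in′ v = 𝟙 (S v) * incidence (tgt G) f v
    S-src S-tgt out′ in″ : Vector ℚ (m G)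
    S-src e = 𝟙 (S (src G e))
    S-tgt e = 𝟙 (S (tgt G e))
    out′ e = S-src e * f e
    in″ e = S-tgt e * f e

  flowValue≡flowAcross : ∀ {c s t f} → IsFlow G c s t f → (S : Fin (n G) → Bool) →
                         S s ≡ true → (∀ v → S v ≡ true → v ≢ s → v ≢ t) →
                         flowValue G f s ≡ flowAcross S f
  flowValue≡flowAcross {s = s} {f = f} flow S Ss S∖s∌t = begin
    flowValue G f s                  ≡⟨ flowValue≡net f s ⟩
    net f s                          ≡⟨ sum-δ s (net f) ⟨
    sum (λ v → δ s v * net f v)      ≡⟨ sum-cong-≗ 𝟙≈δ ⟨
    sum (λ v → 𝟙 (S v) * net f v)    ≡⟨ sum-net≡flowAcross S f ⟩
    flowAcross S f                   ∎
    where
    open ≡-Reasoning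
    𝟙≈δ : ∀ v → 𝟙 (S v) * net f v ≡ δ s v * net f v
    𝟙≈δ v with s ≟ v | S v in Sv
    ... | yes refl | _     = cong (λ b → 𝟙 b * net f s) (trans (sym Sv) Ss)
    ... | no _     | false = refl
    ... | no s≢v   | true  = begin
      1ℚ * net f v   ≡⟨ cong (1ℚ *_) (net≡0 flow v (s≢v ∘ sym) (S∖s∌t v Sv (s≢v ∘ sym))) ⟩
      0ℚ             ≡⟨ ℚP.*-zeroˡ (net f v) ⟨
      0ℚ * net f v   ∎

  flowAcross≤cutCap : ∀ {c f} → (∀ e → 0ℚ ≤ f e) → (∀ e → f e ≤ c e) →
                      ∀ S → flowAcross S f ≤ cutCap c S
  flowAcross≤cutCap {c} {f} f≥0 f≤c S = sum-mono term≤
    where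
    term≤ : ∀ e → (𝟙 (S (src G e)) - 𝟙 (S (tgt G e))) * f e ≤ 𝟙 (crosses G S e) * c e
    term≤ e rewrite crosses≡ S e with S (src G e) | S (tgt G e)
    ... | true  | true  = ℚP.≤-reflexive (trans (ℚP.*-zeroˡ (f e)) (sym (ℚP.*-zeroˡ (c e))))
    ... | true  | false = subst₂ _≤_ (sym (ℚP.*-identityˡ (f e))) (sym (ℚP.*-identityˡ (c e))) (f≤c e)
    ... | false | true  = begin
      (0ℚ - 1ℚ) * f e   ≡⟨ -1*x≈-x (f e) ⟩
      - f e             ≤⟨ ℚP.neg-antimono-≤ (f≥0 e) ⟩
      0ℚ                ≡⟨ ℚP.*-zeroˡ (c e) ⟨
      0ℚ * c e          ∎
      where open ℚP.≤-Reasoning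
    ... | false | false = ℚP.≤-reflexive (trans (ℚP.*-zeroˡ (f e)) (sym (ℚP.*-zeroˡ (c e))))

  flowValue≤cutCap : ∀ {c s t f} → IsFlow G c s t f → ∀ S → IsCut G s t S → flowValue G f s ≤ cutCap c S
  flowValue≤cutCap {c} {s} {t} {f} flow S (Ss , St) = begin
    flowValue G f s  ≡⟨ flowValue≡flowAcross flow S Ss t∉S ⟩
    flowAcross S f   ≤⟨ flowAcross≤cutCap (IsFlow.nonneg flow) (IsFlow.capacity flow) S ⟩
    cutCap c S       ∎
    where
    open ℚP.≤-Reasoning
    t∉S : ∀ v → S v ≡ true → v ≢ s → v ≢ t
    t∉S v Sv _ refl = contradiction (trans (sym Sv) St) λ ()

  cutCap≤sum : ∀ {c} → (∀ e → 0ℚ ≤ c e) → ∀ S → cutCap c S ≤ sum c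
  cutCap≤sum {c} c≥0 S = sum-mono term≤
    where
    term≤ : ∀ e → 𝟙 (crosses G S e) * c e ≤ c e
    term≤ e with crosses G S e
    ... | true  = ℚP.≤-reflexive (ℚP.*-identityˡ (c e))
    ... | false = subst (_≤ c e) (sym (ℚP.*-zeroˡ (c e))) (c≥0 e)

  flowValue-loop : ∀ {c s f} → IsFlow G c s s f → flowValue G f s ≡ 0ℚ
  flowValue-loop {s = s} {f = f} flow = begin
    flowValue G f s               ≡⟨ flowValue≡flowAcross flow (λ _ → true) refl (λ _ _ v≢s v≡s → v≢s v≡s) ⟩
    sum (λ e → (1ℚ - 1ℚ) * f e)   ≡⟨ sum-zero (λ e → ℚP.*-zeroˡ (f e)) ⟩
    0ℚ                            ∎
    where open ≡-Reasoning

  net-zero : ∀ v → net (λ _ → 0ℚ) v ≡ 0ℚ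
  net-zero v = cong₂ _-_ (sum-zero (λ e → ℚP.*-zeroʳ (δ (src G e) v)))
                         (sum-zero (λ e → ℚP.*-zeroʳ (δ (tgt G e) v)))

  zeroFlow : ∀ {c s t} → (∀ e → 0ℚ ≤ c e) → IsFlow G c s t (λ _ → 0ℚ)
  zeroFlow c≥0 = record
    { nonneg       = λ _ → ℚP.≤-refl
    ; capacity     = c≥0
    ; conservation = λ v _ _ → balanced⇒conservation (λ _ → 0ℚ) v (net-zero v)
    }

  maxFlowValue-loop≡0 : ∀ {c s v} → IsMaxFlowValue G c s s v → v ≡ 0ℚ
  maxFlowValue-loop≡0 ((f , isFlow , value≡v) , _) = trans (sym value≡v) (flowValue-loop isFlow)

  maxFlowValue-loop : ∀ {c s} → (∀ e → 0ℚ ≤ c e) → IsMaxFlowValue G c s s 0ℚ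
  maxFlowValue-loop {s = s} c≥0 =
    ((λ _ → 0ℚ) , zeroFlow c≥0 , trans (flowValue≡net (λ _ → 0ℚ) s) (net-zero s)) ,
    λ f flow → ℚP.≤-reflexive (flowValue-loop flow)

  IsFlow-resp-capacity : ∀ {c c′ s t f} → (∀ e → c e ≡ c′ e) → IsFlow G c s t f → IsFlow G c′ s t f
  IsFlow-resp-capacity c≗c′ flow = record
    { nonneg       = IsFlow.nonneg flow
    ; capacity     = λ e → subst (_ ≤_) (c≗c′ e) (IsFlow.capacity flow e)
    ; conservation = IsFlow.conservation flow
    }

  incidence-update : ∀ end {h h′ : Vector ℚ (m G)} e d → (∀ i → h′ i ≡ h i + δ e i * d) →
                     ∀ v → incidence end h′ v ≡ incidence end h v + δ (end e) v * d
  incidence-update end {h} {h′} e d h′≗h+δd v = begin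
    sum (λ i → δ (end i) v * h′ i)        ≡⟨ sum-cong-≗ split ⟩
    sum (λ i → old i + new i)             ≡⟨ ∑-distrib-+ old new ⟩
    sum old + sum new                     ≡⟨ cong (sum old +_) (sum-δ e (λ i → δ (end i) v * d)) ⟩
    incidence end h v + δ (end e) v * d   ∎
    where
    open ≡-Reasoning
    old new : Vector ℚ (m G)
    old i = δ (end i) v * h i
    new i = δ e i * (δ (end i) v * d)
    split : ∀ i → δ (end i) v * h′ i ≡ old i + new i
    split i = begin
      δ (end i) v * h′ i                  ≡⟨ cong (δ (end i) v *_) (h′≗h+δd i) ⟩
      δ (end i) v * (h i + δ e i * d)     ≡⟨ ℚP.*-distribˡ-+ (δ (end i) v) (h i) _ ⟩
      old i + δ (end i) v * (δ e i * d)   ≡⟨ cong (old i +_) (x∙yz≈y∙xz (δ (end i) v) (δ e i) d) ⟩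
      old i + new i                       ∎

  net-update : ∀ {h h′ : Vector ℚ (m G)} e d → (∀ i → h′ i ≡ h i + δ e i * d) →
               ∀ v → net h′ v ≡ net h v + (δ (src G e) v - δ (tgt G e) v) * d
  net-update {h} {h′} e d h′≗h+δd v = begin
    net h′ v
      ≡⟨ cong₂ _-_ (incidence-update (src G) e d h′≗h+δd v) (incidence-update (tgt G) e d h′≗h+δd v) ⟩
    (O + a * d) - (I + b * d)
      ≡⟨ solve 5 (λ O I a b d → (O :+ a :* d) :- (I :+ b :* d) := (O :- I) :+ (a :- b) :* d) refl O I a b d ⟩
    net h v + (a - b) * d
      ∎
    where
    open ≡-Reasoning
    O = incidence (src G) h v
    I = incidence (tgt G) h v
    a = δ (src G e) v
    b = δ (tgt G e) v

record FlowCutPair (G : Graph) (c : Vector ℚ (m G)) (s t : Fin (n G)) : Set where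
  field
    flow   : Vector ℚ (m G)
    cut    : Fin (n G) → Bool
    isFlow : IsFlow G c s t flow
    isCut  : IsCut G s t cut
    tight  : flowValue G flow s ≡ cutCap G c cut

-- Integral max-flow min-cut, by augmenting paths

module IntegralMaxFlowMinCut (G : Graph) {s t : Fin (n G)} (s≢t : s ≢ t) (k : Vector ℕ (m G)) where

  record IntegralFlow : Set where
    field
      flow     : Vector ℕ (m G)
      flow≤k   : ∀ e → flow e ℕ.≤ k e
      balanced : ∀ v → v ≢ s → v ≢ t → net G (ℕ→ℚ ∘ flow) v ≡ 0ℚ

    isFlow : IsFlow G (ℕ→ℚ ∘ k) s t (ℕ→ℚ ∘ flow)
    isFlow = record
      { nonneg       = ℕ→ℚ-nonNeg ∘ flow
      ; capacity     = ℕ→ℚ-mono-≤ ∘ flow≤k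
      ; conservation = λ v v≢s v≢t → balanced⇒conservation G (ℕ→ℚ ∘ flow) v (balanced v v≢s v≢t)
      }

  value : IntegralFlow → ℚ
  value F = net G (ℕ→ℚ ∘ IntegralFlow.flow F) s

  data ResidualEdge (f : Vector ℕ (m G)) (e : Fin (m G)) : Fin (n G) → Fin (n G) → Set where
    forward  : f e ℕ.< k e → ResidualEdge f e (src G e) (tgt G e)
    backward : 0 ℕ.< f e   → ResidualEdge f e (tgt G e) (src G e)

  residual? : ∀ f e u w → Dec (ResidualEdge f e u w)
  residual? f e u w = map′ fromCases toCases
    ((src G e ≟ u ×-dec tgt G e ≟ w ×-dec f e ℕ.<? k e) ⊎-dec (tgt G e ≟ u ×-dec src G e ≟ w ×-dec 0 ℕ.<? f e))
    where
    Cases : Set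
    Cases = (src G e ≡ u × tgt G e ≡ w × f e ℕ.< k e) ⊎ (tgt G e ≡ u × src G e ≡ w × 0 ℕ.< f e)
    fromCases : Cases → ResidualEdge f e u w
    fromCases (inj₁ (refl , refl , f<k)) = forward f<k
    fromCases (inj₂ (refl , refl , 0<f)) = backward 0<f
    toCases : ResidualEdge f e u w → Cases
    toCases (forward f<k)  = inj₁ (refl , refl , f<k)
    toCases (backward 0<f) = inj₂ (refl , refl , 0<f)

  residual-resp : ∀ {f g e u w} → g e ≡ f e → ResidualEdge f e u w → ResidualEdge g e u w
  residual-resp ge≡fe (forward f<k)  = forward (subst (ℕ._< k _) (sym ge≡fe) f<k)
  residual-resp ge≡fe (backward 0<f) = backward (subst (0 ℕ.<_) (sym ge≡fe) 0<f)

  record UnitShift (g : Vector ℕ (m G)) (u w : Fin (n G)) (Fixed : Fin (m G) → Set) : Set where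
    field
      flow′     : Vector ℕ (m G)
      flow′≤k   : ∀ e → flow′ e ℕ.≤ k e
      fixed     : ∀ e → Fixed e → flow′ e ≡ g e
      net-shift : ∀ v → net G (ℕ→ℚ ∘ flow′) v ≡ net G (ℕ→ℚ ∘ g) v + (δ u v - δ w v)

  open UnitShift

  UnitShift-weaken : ∀ {g u w} {P Q : Fin (m G) → Set} → (∀ e → P e → Q e) →
                     UnitShift g u w Q → UnitShift g u w P
  UnitShift-weaken P⊆Q A = record
    { flow′ = flow′ A ; flow′≤k = flow′≤k A ; fixed = λ e → fixed A e ∘ P⊆Q e ; net-shift = net-shift A }

  UnitShift-refl : ∀ {g u} → (∀ e → g e ℕ.≤ k e) → UnitShift g u u (λ _ → ⊤)
  UnitShift-refl {g} {u} g≤k = record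
    { flow′     = g
    ; flow′≤k   = g≤k
    ; fixed     = λ _ _ → refl
    ; net-shift = λ v → sym (trans (cong (net G (ℕ→ℚ ∘ g) v +_) (ℚP.+-inverseʳ (δ u v))) (ℚP.+-identityʳ _))
    }

  UnitShift-trans : ∀ {g u v w P Q} (A : UnitShift g u v P) → UnitShift (flow′ A) v w Q →
                    UnitShift g u w (λ e → P e × Q e)
  UnitShift-trans {g} {u} {v} {w} A B = record
    { flow′     = flow′ B
    ; flow′≤k   = flow′≤k B
    ; fixed     = λ e (Pe , Qe) → trans (fixed B e Qe) (fixed A e Pe)
    ; net-shift = net-shift′
    }
    where
    open ≡-Reasoning
    telescope : ∀ N a b c → N + (a - b) + (b - c) ≡ N + (a - c)
    telescope = solve 4 (λ N a b c → N :+ (a :- b) :+ (b :- c) := N :+ (a :- c)) refl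
    net-shift′ : ∀ x → net G (ℕ→ℚ ∘ flow′ B) x ≡ net G (ℕ→ℚ ∘ g) x + (δ u x - δ w x)
    net-shift′ x = begin
      net G (ℕ→ℚ ∘ flow′ B) x                     ≡⟨ net-shift B x ⟩
      net G (ℕ→ℚ ∘ flow′ A) x + (δ v x - δ w x)   ≡⟨ cong (_+ (δ v x - δ w x)) (net-shift A x) ⟩
      N + (δ u x - δ v x) + (δ v x - δ w x)       ≡⟨ telescope N (δ u x) (δ v x) (δ w x) ⟩
      N + (δ u x - δ w x)                         ∎
      where N = net G (ℕ→ℚ ∘ g) x

  updateAt-≤k : ∀ {g} e {φ : ℕ → ℕ} → (∀ i → g i ℕ.≤ k i) → φ (g e) ℕ.≤ k e →
                ∀ i → updateAt g e φ i ℕ.≤ k i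
  updateAt-≤k {g} e g≤k φ≤k i with e ≟ i
  ... | yes refl = subst (ℕ._≤ k e) (sym (updateAt-updates e g)) φ≤k
  ... | no e≢i   = subst (ℕ._≤ k i) (sym (updateAt-minimal i e g (e≢i ∘ sym))) (g≤k i)

  push : ∀ {g e u w} → (∀ i → g i ℕ.≤ k i) → ResidualEdge g e u w → UnitShift g u w (e ≢_)
  push {g} {e} g≤k (forward g<k) = record
    { flow′     = updateAt g e suc
    ; flow′≤k   = updateAt-≤k e g≤k g<k
    ; fixed     = λ i e≢i → updateAt-minimal i e g (e≢i ∘ sym)
    ; net-shift = λ v → trans (net-update G e 1ℚ (ℕ→ℚ-updateAt g e 1ℚ (ℚP.+-comm 1ℚ (ℕ→ℚ (g e)))) v)
                              (cong (net G (ℕ→ℚ ∘ g) v +_) (ℚP.*-identityʳ _))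
    }
  push {g} {e} g≤k (backward 0<g) = record
    { flow′     = updateAt g e ℕ.pred
    ; flow′≤k   = updateAt-≤k e g≤k (ℕP.≤-trans ℕP.pred[n]≤n (g≤k e))
    ; fixed     = λ i e≢i → updateAt-minimal i e g (e≢i ∘ sym)
    ; net-shift = λ v → trans (net-update G e (- 1ℚ) (ℕ→ℚ-updateAt g e (- 1ℚ) (ℕ→ℚ-pred 0<g)) v)
                              (cong (net G (ℕ→ℚ ∘ g) v +_) (reverse (δ (tgt G e) v) (δ (src G e) v)))
    }
    where
    reverse : ∀ a b → (b - a) * - 1ℚ ≡ a - b
    reverse = solve 2 (λ a b → (b :- a) :* (:- con 1ℚ) := a :- b) refl

  module Residual (F : IntegralFlow) where
    open IntegralFlow F

    Reach : ℕ → Fin (n G) → Set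
    Reach zero    w = w ≡ s
    Reach (suc j) w = Reach j w ⊎ ∃₂ λ u e → Reach j u × ResidualEdge flow e u w

    reach? : ∀ j w → Dec (Reach j w)
    reach? zero    w = w ≟ s
    reach? (suc j) w = reach? j w ⊎-dec any? λ u → any? λ e → reach? j u ×-dec residual? flow e u w

    reach-s : ∀ j → Reach j s
    reach-s zero    = refl
    reach-s (suc j) = inj₁ (reach-s j)

    layer : ℕ → Fin (n G) → Bool
    layer j w = does (reach? j w)

    Stable : ℕ → Set
    Stable j = ∀ w → Reach (suc j) w → Reach j w

    stable-or-grows : ∀ j → Stable j ⊎ countℕ (layer j) ℕ.< countℕ (layer (suc j))
    stable-or-grows j with any? (λ w → reach? (suc j) w ×-dec ¬? (reach? j w))
    ... | yes (w , r , ¬r) =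
      inj₂ (countℕ-mono-< layer-⊆ w (dec-false (reach? j w) ¬r) (dec-true (reach? (suc j) w) r))
      where
      layer-⊆ : ∀ w → layer j w ≡ true → layer (suc j) w ≡ true
      layer-⊆ w r = dec-true (reach? (suc j) w) (inj₁ (does-true (reach? j w) r))
    ... | no ∄ = inj₁ stable
      where
      stable : Stable j
      stable w r with reach? j w
      ... | yes r′ = r′
      ... | no ¬r  = contradiction (w , r , ¬r) ∄

    -- Until the layers stabilise they grow strictly, and layer j has at most n elements.
    stabilizes : ∃ Stable
    stabilizes = search (suc (n G)) 0 ℕ.z≤n (ℕP.+-identityʳ (suc (n G)))
      where
      search : ∀ fuel j → j ℕ.≤ countℕ (layer j) → fuel ℕ.+ j ≡ suc (n G) → ∃ Stable
      search zero       j j≤size refl = contradiction (ℕP.≤-trans j≤size (countℕ-≤ (layer j))) (ℕP.n≮n (n G))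
      search (suc fuel) j j≤size eq with stable-or-grows j
      ... | inj₁ stable = j , stable
      ... | inj₂ grows  =
        search fuel (suc j) (ℕP.≤-trans (ℕ.s≤s j≤size) grows) (trans (ℕP.+-suc fuel j) eq)

    OutsideLayer : ℕ → Fin (m G) → Set
    OutsideLayer j e = ¬ Reach j (src G e) ⊎ ¬ Reach j (tgt G e)

    outside-pred : ∀ {j e} → OutsideLayer (suc j) e → OutsideLayer j e
    outside-pred (inj₁ ¬r) = inj₁ (¬r ∘ inj₁)
    outside-pred (inj₂ ¬r) = inj₂ (¬r ∘ inj₁)

    head-outside : ∀ {g e u w j} → ResidualEdge g e u w → ¬ Reach j w → OutsideLayer j e
    head-outside (forward _)  ¬rw = inj₂ ¬rw
    head-outside (backward _) ¬rw = inj₁ ¬rw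

    ends-inside : ∀ {g e u w j} → ResidualEdge g e u w → Reach j u → Reach j w → ¬ OutsideLayer j e
    ends-inside (forward _)  ru rw (inj₁ ¬ru) = ¬ru ru
    ends-inside (forward _)  ru rw (inj₂ ¬rw) = ¬rw rw
    ends-inside (backward _) ru rw (inj₁ ¬rw) = ¬rw rw
    ends-inside (backward _) ru rw (inj₂ ¬ru) = ¬ru ru

    -- Since edges touching the outside of
    -- layer j keep their flow, the residual edge u → w into a new vertex w is still
    -- residual after augmenting up to u.
    augment : ∀ j w → Reach j w → UnitShift flow s w (OutsideLayer j)
    augment zero    w refl     = UnitShift-weaken (λ _ _ → tt) (UnitShift-refl flow≤k)
    augment (suc j) w (inj₁ r) = UnitShift-weaken (λ _ → outside-pred) (augment j w r)
    augment (suc j) w (inj₂ (u , e , ru , e:u→w)) with reach? j w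
    ... | yes rw = UnitShift-weaken (λ _ → outside-pred) (augment j w rw)
    ... | no ¬rw = UnitShift-weaken fixed-suc (UnitShift-trans A (push (flow′≤k A) e:u→w′))
      where
      A = augment j u ru
      e:u→w′ : ResidualEdge (flow′ A) e u w
      e:u→w′ = residual-resp (fixed A e (head-outside e:u→w ¬rw)) e:u→w
      fixed-suc : ∀ i → OutsideLayer (suc j) i → OutsideLayer j i × e ≢ i
      fixed-suc i out = outside-pred out , λ { refl → ends-inside e:u→w (inj₁ ru) (inj₂ (u , e , ru , e:u→w)) out }

    layer-isCut : ∀ j → ¬ Reach j t → IsCut G s t (layer j)
    layer-isCut j ¬rt = dec-true (reach? j s) (reach-s j) , dec-false (reach? j t) ¬rt

    layer-tight : ∀ j → Stable j → ¬ Reach j t →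
                  flowValue G (ℕ→ℚ ∘ flow) s ≡ cutCap G (ℕ→ℚ ∘ k) (layer j)
    layer-tight j stable ¬rt =
      trans (flowValue≡flowAcross G isFlow (layer j) (proj₁ (layer-isCut j ¬rt)) t∉layer) (sum-cong-≗ term≡)
      where
      t∉layer : ∀ v → layer j v ≡ true → v ≢ s → v ≢ t
      t∉layer v inLayer _ refl = ¬rt (does-true (reach? j t) inLayer)
      saturated : ∀ e → Reach j (src G e) → ¬ Reach j (tgt G e) → flow e ≡ k e
      saturated e rs ¬rt = ℕP.≤-antisym (flow≤k e)
        (ℕP.≮⇒≥ λ f<k → ¬rt (stable (tgt G e) (inj₂ (src G e , e , rs , forward f<k))))
      empty : ∀ e → ¬ Reach j (src G e) → Reach j (tgt G e) → flow e ≡ 0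
      empty e ¬rs rt = ℕP.n≤0⇒n≡0
        (ℕP.≮⇒≥ λ 0<f → ¬rs (stable (src G e) (inj₂ (tgt G e , e , rt , backward 0<f))))
      term≡ : ∀ e → (𝟙 (layer j (src G e)) - 𝟙 (layer j (tgt G e))) * ℕ→ℚ (flow e)
                    ≡ 𝟙 (crosses G (layer j) e) * ℕ→ℚ (k e)
      term≡ e rewrite crosses≡ G (layer j) e with reach? j (src G e) | reach? j (tgt G e)
      ... | yes _  | yes _  = trans (ℚP.*-zeroˡ (ℕ→ℚ (flow e))) (sym (ℚP.*-zeroˡ (ℕ→ℚ (k e))))
      ... | no _   | no _   = trans (ℚP.*-zeroˡ (ℕ→ℚ (flow e))) (sym (ℚP.*-zeroˡ (ℕ→ℚ (k e))))
      ... | yes rs | no ¬rt = cong (λ x → 1ℚ * ℕ→ℚ x) (saturated e rs ¬rt)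
      ... | no ¬rs | yes rt =
        trans (cong (λ x → (0ℚ - 1ℚ) * ℕ→ℚ x) (empty e ¬rs rt)) (sym (ℚP.*-zeroˡ (ℕ→ℚ (k e))))

  singleton : Fin (n G) → Bool
  singleton v = does (s ≟ v)

  singleton-isCut : IsCut G s t singleton
  singleton-isCut = dec-true (s ≟ s) refl , dec-false (s ≟ t) s≢t

  flowValue≤totalCapacity : ∀ {f} → IsFlow G (ℕ→ℚ ∘ k) s t f → flowValue G f s ≤ ℕ→ℚ (sumℕ k)
  flowValue≤totalCapacity {f} isFlow = begin
    flowValue G f s                ≤⟨ flowValue≤cutCap G isFlow singleton singleton-isCut ⟩
    cutCap G (ℕ→ℚ ∘ k) singleton   ≤⟨ cutCap≤sum G (ℕ→ℚ-nonNeg ∘ k) singleton ⟩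
    sum (ℕ→ℚ ∘ k)                  ≡⟨ sum-ℕ→ℚ k ⟩
    ℕ→ℚ (sumℕ k)                   ∎
    where open ℚP.≤-Reasoning

  zeroIntegralFlow : IntegralFlow
  zeroIntegralFlow = record { flow = λ _ → 0 ; flow≤k = λ _ → ℕ.z≤n ; balanced = λ v _ _ → net-zero G v }

  augmentBy : ∀ {P} (F : IntegralFlow) → UnitShift (IntegralFlow.flow F) s t P → IntegralFlow
  augmentBy F A = record
    { flow     = flow′ A
    ; flow≤k   = flow′≤k A
    ; balanced = λ v v≢s v≢t → begin
        net G (ℕ→ℚ ∘ flow′ A) v
          ≡⟨ net-shift A v ⟩
        net G (ℕ→ℚ ∘ IntegralFlow.flow F) v + (δ s v - δ t v)
          ≡⟨ cong₂ (λ x y → x + (y - δ t v)) (IntegralFlow.balanced F v v≢s v≢t) (δ-≢ (v≢s ∘ sym)) ⟩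
        0ℚ + (0ℚ - δ t v)
          ≡⟨ cong (λ y → 0ℚ + (0ℚ - y)) (δ-≢ (v≢t ∘ sym)) ⟩
        0ℚ
          ∎
    }
    where open ≡-Reasoning

  augmentBy-value : ∀ {P} (F : IntegralFlow) (A : UnitShift (IntegralFlow.flow F) s t P) →
                    value (augmentBy F A) ≡ 1ℚ + value F
  augmentBy-value F A = begin
    value (augmentBy F A)       ≡⟨ net-shift A s ⟩
    value F + (δ s s - δ t s)   ≡⟨ cong₂ (λ x y → value F + (x - y)) (δ-refl s) (δ-≢ (s≢t ∘ sym)) ⟩
    value F + 1ℚ                ≡⟨ ℚP.+-comm (value F) 1ℚ ⟩
    1ℚ + value F                ∎
    where open ≡-Reasoning

  -- Each augmentation raises the value by one and no value exceeds the total capacity,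
  -- so sumℕ k + 1 rounds suffice.
  maxFlowMinCut : FlowCutPair G (ℕ→ℚ ∘ k) s t
  maxFlowMinCut = improve (suc (sumℕ k)) zeroIntegralFlow 0 (net-zero G s) (ℕP.n<1+n (sumℕ k))
    where
    improve : ∀ fuel (F : IntegralFlow) v → value F ≡ ℕ→ℚ v →
              sumℕ k ℕ.< v ℕ.+ fuel → FlowCutPair G (ℕ→ℚ ∘ k) s t
    improve zero F v value≡v total<v = contradiction
      (ℕ→ℚ-cancel-≤ (subst (_≤ ℕ→ℚ (sumℕ k)) (trans (flowValue≡net G _ s) value≡v)
                                             (flowValue≤totalCapacity (IntegralFlow.isFlow F))))
      (ℕP.<⇒≱ (subst (sumℕ k ℕ.<_) (ℕP.+-identityʳ v) total<v))
    improve (suc fuel) F v value≡v total<v with Residual.stabilizes F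
    ... | j , stable with Residual.reach? F j t
    ...   | no ¬rt = record
      { flow   = ℕ→ℚ ∘ IntegralFlow.flow F
      ; cut    = Residual.layer F j
      ; isFlow = IntegralFlow.isFlow F
      ; isCut  = Residual.layer-isCut F j ¬rt
      ; tight  = Residual.layer-tight F j stable ¬rt
      }
    ...   | yes rt = improve fuel (augmentBy F A) (suc v)
      (trans (augmentBy-value F A) (cong (1ℚ +_) value≡v)) (subst (sumℕ k ℕ.<_) (ℕP.+-suc v fuel) total<v)
      where A = Residual.augment F j t rt

open IntegralMaxFlowMinCut using (maxFlowMinCut)

-- Critical edges and the reweighted graph

crossing⇒critical : ∀ G {s t S e} → IsMinCut G s t S → crosses G S e ≡ true → Critical G s t e
crossing⇒critical G {S = S} {e} minCut crossing
  with S (src G e) in Ss | S (tgt G e) in St | trans (sym (crosses≡ G S e)) crossing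
... | true  | false | _ = S , minCut , Ss , St
... | true  | true  | ()
... | false | _     | ()

loop-notCritical : ∀ G {s e} → ¬ Critical G s s e
loop-notCritical G (S , ((Ss , S¬s) , _) , _) = contradiction (trans (sym Ss) S¬s) λ ()

cutCap-unit : ∀ G S → cutCap G (unitCap G) S ≡ ℕ→ℚ (cutValue G S)
cutCap-unit G S = trans (sum-count (crosses G S) 1ℚ) (ℚP.*-identityʳ _)

unitMaxFlow≡minCut : ∀ G {s t λ′} → s ≢ t → IsMaxFlowValue G (unitCap G) s t λ′ →
                     Σ (Fin (n G) → Bool) λ S → IsMinCut G s t S × λ′ ≡ ℕ→ℚ (cutValue G S)
unitMaxFlow≡minCut G {s} {t} {λ′} s≢t ((f , f-isFlow , f-value≡λ′) , maximal) =
  cut , (isCut , minimal) , λ′≡cut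
  where
  open FlowCutPair (maxFlowMinCut G s≢t (λ _ → 1))
  value≡cut : flowValue G flow s ≡ ℕ→ℚ (cutValue G cut)
  value≡cut = trans tight (cutCap-unit G cut)
  λ′≡cut : λ′ ≡ ℕ→ℚ (cutValue G cut)
  λ′≡cut = ℚP.≤-antisym
    (subst₂ _≤_ f-value≡λ′ (cutCap-unit G cut) (flowValue≤cutCap G f-isFlow cut isCut))
    (subst (_≤ λ′) value≡cut (maximal flow isFlow))
  minimal : ∀ S′ → IsCut G s t S′ → cutValue G cut ℕ.≤ cutValue G S′
  minimal S′ S′-cut = ℕ→ℚ-cancel-≤
    (subst₂ _≤_ value≡cut (cutCap-unit G S′) (flowValue≤cutCap G isFlow S′ S′-cut))

module Reweighting (G : Graph) {s t : Fin (n G)} (s≢t : s ≢ t) {λ′ : ℚ}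
                   (maxλ : IsMaxFlowValue G (unitCap G) s t λ′) (c : Vector ℚ (m G))
                   (c-spec : ∀ e → (Critical G s t e → c e ≡ λ′ + 1ℚ) × (¬ Critical G s t e → c e ≡ λ′))
                   where

  S₀ : Fin (n G) → Bool
  S₀ = proj₁ (unitMaxFlow≡minCut G s≢t maxλ)

  S₀-isMinCut : IsMinCut G s t S₀
  S₀-isMinCut = proj₁ (proj₂ (unitMaxFlow≡minCut G s≢t maxλ))

  ℓ : ℕ
  ℓ = cutValue G S₀

  λ′≡ℓ : λ′ ≡ ℕ→ℚ ℓ
  λ′≡ℓ = proj₂ (proj₂ (unitMaxFlow≡minCut G s≢t maxλ))

  minCut-value : ∀ S → IsMinCut G s t S → cutValue G S ≡ ℓ
  minCut-value S (S-cut , S-min) = ℕP.≤-antisym (S-min S₀ (proj₁ S₀-isMinCut)) (proj₂ S₀-isMinCut S S-cut)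

  -- Criticality is not decided; comparing c e with λ′ + 1 tells which half of c-spec applies.
  c-cases : ∀ e → c e ≡ λ′ + 1ℚ ⊎ c e ≡ λ′
  c-cases e with c e ℚP.≟ λ′ + 1ℚ
  ... | yes c≡λ+1 = inj₁ c≡λ+1
  ... | no  c≢λ+1 = inj₂ (proj₂ (c-spec e) (c≢λ+1 ∘ proj₁ (c-spec e)))

  c-integral : ∀ e → Σ ℕ λ x → ℕ→ℚ x ≡ c e
  c-integral e with c-cases e
  ... | inj₁ c≡λ+1 = suc ℓ , trans (ℚP.+-comm 1ℚ (ℕ→ℚ ℓ)) (sym (trans c≡λ+1 (cong (_+ 1ℚ) λ′≡ℓ)))
  ... | inj₂ c≡λ   = ℓ , sym (trans c≡λ λ′≡ℓ)

  λ′≤c : ∀ e → λ′ ≤ c e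
  λ′≤c e with c-cases e
  ... | inj₁ c≡λ+1 = subst (λ′ ≤_) (sym c≡λ+1) (ℚP.<⇒≤ λ′<λ′+1)
    where
    λ′<λ′+1 : λ′ < λ′ + 1ℚ
    λ′<λ′+1 = ℚP.<-respˡ-≡ (ℚP.+-identityʳ λ′) (ℚP.+-monoʳ-< λ′ (ℚP.positive⁻¹ 1ℚ))
  ... | inj₂ c≡λ   = ℚP.≤-reflexive (sym c≡λ)

  minCut-capacity : ∀ S → IsMinCut G s t S → cutCap G c S ≡ λ′ * (λ′ + 1ℚ)
  minCut-capacity S minCut = begin
    sum (λ e → 𝟙 (crosses G S e) * c e)         ≡⟨ sum-cong-≗ crossing-critical ⟩
    sum (λ e → 𝟙 (crosses G S e) * (λ′ + 1ℚ))   ≡⟨ sum-count (crosses G S) (λ′ + 1ℚ) ⟩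
    ℕ→ℚ (cutValue G S) * (λ′ + 1ℚ)              ≡⟨ cong (λ x → ℕ→ℚ x * (λ′ + 1ℚ)) (minCut-value S minCut) ⟩
    ℕ→ℚ ℓ * (λ′ + 1ℚ)                           ≡⟨ cong (_* (λ′ + 1ℚ)) λ′≡ℓ ⟨
    λ′ * (λ′ + 1ℚ)                              ∎
    where
    open ≡-Reasoning
    crossing-critical : ∀ e → 𝟙 (crosses G S e) * c e ≡ 𝟙 (crosses G S e) * (λ′ + 1ℚ)
    crossing-critical e with crosses G S e in crossing
    ... | true  = cong (1ℚ *_) (proj₁ (c-spec e) (crossing⇒critical G minCut crossing))
    ... | false = trans (ℚP.*-zeroˡ (c e)) (sym (ℚP.*-zeroˡ (λ′ + 1ℚ)))

  λ′[λ′+1]≤cutCap : ∀ S → IsCut G s t S → λ′ * (λ′ + 1ℚ) ≤ cutCap G c S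
  λ′[λ′+1]≤cutCap S S-cut with cutValue G S ℕ.≟ ℓ
  ... | yes S≡ℓ = ℚP.≤-reflexive (sym (minCut-capacity S (S-cut , S-min)))
    where
    S-min : ∀ S′ → IsCut G s t S′ → cutValue G S ℕ.≤ cutValue G S′
    S-min S′ S′-cut = subst (ℕ._≤ cutValue G S′) (sym S≡ℓ) (proj₂ S₀-isMinCut S′ S′-cut)
  ... | no  S≢ℓ = begin
    λ′ * (λ′ + 1ℚ)                       ≡⟨ ℚP.*-comm λ′ (λ′ + 1ℚ) ⟩
    (λ′ + 1ℚ) * λ′                       ≡⟨ cong (λ x → (x + 1ℚ) * λ′) λ′≡ℓ ⟩
    (ℕ→ℚ ℓ + 1ℚ) * λ′                    ≡⟨ cong (_* λ′) (ℚP.+-comm (ℕ→ℚ ℓ) 1ℚ) ⟩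
    ℕ→ℚ (suc ℓ) * λ′                     ≤⟨ ℚP.*-monoʳ-≤-nonNeg λ′ {{λ′-nonNeg}} (ℕ→ℚ-mono-≤ ℓ<S) ⟩
    ℕ→ℚ (cutValue G S) * λ′              ≡⟨ sum-count (crosses G S) λ′ ⟨
    sum (λ e → 𝟙 (crosses G S e) * λ′)   ≤⟨ sum-mono (λ e → 𝟙*-monoʳ-≤ (crosses G S e) (λ′≤c e)) ⟩
    cutCap G c S                         ∎
    where
    open ℚP.≤-Reasoning
    λ′-nonNeg : ℚ.NonNegative λ′
    λ′-nonNeg = ℚ.nonNegative (subst (0ℚ ≤_) (sym λ′≡ℓ) (ℕ→ℚ-nonNeg ℓ))
    ℓ<S : ℓ ℕ.< cutValue G S
    ℓ<S = ℕP.≤∧≢⇒< (proj₂ S₀-isMinCut S S-cut) (S≢ℓ ∘ sym)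

  flowValue≤λ′[λ′+1] : ∀ f → IsFlow G c s t f → flowValue G f s ≤ λ′ * (λ′ + 1ℚ)
  flowValue≤λ′[λ′+1] f isFlow =
    subst (flowValue G f s ≤_) (minCut-capacity S₀ S₀-isMinCut) (flowValue≤cutCap G isFlow S₀ (proj₁ S₀-isMinCut))

  integralWitness : FlowCutPair G (ℕ→ℚ ∘ proj₁ ∘ c-integral) s t
  integralWitness = maxFlowMinCut G s≢t (proj₁ ∘ c-integral)

  open FlowCutPair integralWitness using (cut; isCut; tight)

  maxFlow : Vector ℚ (m G)
  maxFlow = FlowCutPair.flow integralWitness

  maxFlow-isFlow : IsFlow G c s t maxFlow
  maxFlow-isFlow = IsFlow-resp-capacity G (proj₂ ∘ c-integral) (FlowCutPair.isFlow integralWitness)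

  λ′[λ′+1]≤maxFlow : λ′ * (λ′ + 1ℚ) ≤ flowValue G maxFlow s
  λ′[λ′+1]≤maxFlow =
    subst (λ′ * (λ′ + 1ℚ) ≤_) (sym (trans tight cutCap≡)) (λ′[λ′+1]≤cutCap cut isCut)
    where
    cutCap≡ : cutCap G (ℕ→ℚ ∘ proj₁ ∘ c-integral) cut ≡ cutCap G c cut
    cutCap≡ = sum-cong-≗ λ e → cong (𝟙 (crosses G cut e) *_) (proj₂ (c-integral e))

lemma2 : (G : Graph) (s t : Fin (n G)) (λ′ : ℚ) →
         IsMaxFlowValue G (unitCap G) s t λ′ →
         (c : Fin (m G) → ℚ) →
         (∀ e → (Critical G s t e → c e ≡ λ′ + 1ℚ) × (¬ Critical G s t e → c e ≡ λ′)) →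
         IsMaxFlowValue G c s t (λ′ * (λ′ + 1ℚ))
lemma2 G s t λ′ maxλ c c-spec with s ≟ t
... | yes refl = subst (IsMaxFlowValue G c s s) (sym λ′[λ′+1]≡0) (maxFlowValue-loop G c≥0)
  where
  λ′≡0 : λ′ ≡ 0ℚ
  λ′≡0 = maxFlowValue-loop≡0 G maxλ
  c≥0 : ∀ e → 0ℚ ≤ c e
  c≥0 e = ℚP.≤-reflexive (sym (trans (proj₂ (c-spec e) (loop-notCritical G)) λ′≡0))
  λ′[λ′+1]≡0 : λ′ * (λ′ + 1ℚ) ≡ 0ℚ
  λ′[λ′+1]≡0 = trans (cong (_* (λ′ + 1ℚ)) λ′≡0) (ℚP.*-zeroˡ (λ′ + 1ℚ))
... | no s≢t =
  (maxFlow , maxFlow-isFlow , ℚP.≤-antisym (flowValue≤λ′[λ′+1] maxFlow maxFlow-isFlow) λ′[λ′+1]≤maxFlow) ,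
  flowValue≤λ′[λ′+1]
  where open Reweighting G s≢t maxλ c c-spec
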